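{- Let $G$ be a simple connected graph of order $n\geq 3$, and let $V=V(G)\subseteq V(R(G))$. Then $V$ contains a differential set $S$ of $R(G)$ such that $S$ is a dominating set of $G$.
   Context: $R(G)$ is the graph obtained from $G$ by adding, for each edge $e=xy\in E(G)$, a new vertex $v_e$ adjacent exactly to $x$ and $y$. For a graph $H$ and $S\subseteq V(H)$, $B_H(S)$ is the set of vertices not in $S$ adjacent to some vertex of $S$, $\partial_H(S)=|B_H(S)|-|S|$, $\partial(H)=\max_{S\subseteq V(H)}\partial_H(S)$, and $S$ is a differential set of $H$ if $\partial_H(S)=\partial(H)$. A dominating set of $G$ is a set $S$ such that every vertex of $G$ is in $S$ or adjacent in $G$ to a vertex of $S$. -}

module Defs where

open import Data.Nat using (ℕ; _<ᵇ_)
open import Data.Fin using (Fin; toℕ; _≟_; _↑ˡ_; _↑ʳ_; splitAt)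
open import Data.Fin.Subset using (Subset; _∈_; ∣_∣)
open import Data.Bool using (Bool; true; false; _∧_; _∨_; not; if_then_else_)
open import Data.Vec using (Vec; tabulate; lookup; _++_; replicate)
open import Data.List using (List; []; _∷_; concatMap; length)
import Data.List as L
import Data.Bool.ListAction as BLA
open import Data.List.Base using (allFin)
open import Data.Product using (_×_; _,_; Σ; ∃; proj₁; proj₂)
open import Data.Sum using (_⊎_; inj₁; inj₂)
open import Data.Integer using (ℤ; +_; _-_; _≤_)
open import Relation.Nullary.Decidable using (⌊_⌋)
open import Relation.Binary.PropositionalEquality using (_≡_)

record SimpleGraph (n : ℕ) : Set where
  field
    adj   : Fin n → Fin n → Bool
    sym   : ∀ i j → adj i j ≡ adj j i
    irrefl : ∀ i → adj i i ≡ false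
open SimpleGraph public

data Walk {n : ℕ} (G : SimpleGraph n) : Fin n → Fin n → Set where
  here : ∀ {i} → Walk G i i
  step : ∀ {i j k} → adj G i j ≡ true → Walk G j k → Walk G i k

Connected : ∀ {n} → SimpleGraph n → Set
Connected {n} G = ∀ (i j : Fin n) → Walk G i j

record FinGraph : Set where
  field
    N    : ℕ
    adjH : Fin N → Fin N → Bool
open FinGraph public

edges : ∀ {n} → SimpleGraph n → List (Fin n × Fin n)
edges {n} G = concatMap (λ i → concatMap (λ j →
  if (toℕ i <ᵇ toℕ j) ∧ adj G i j then (i , j) ∷ [] else []) (allFin n)) (allFin n)

#E : ∀ {n} → SimpleGraph n → ℕ
#E G = length (edges G)

edgeAt : ∀ {n} (G : SimpleGraph n) → Fin (#E G) → Fin n × Fin n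
edgeAt G k = L.lookup (edges G) k

_==_ : ∀ {n} → Fin n → Fin n → Bool
i == j = ⌊ i ≟ j ⌋

inc : ∀ {n} (G : SimpleGraph n) → Fin n → Fin (#E G) → Bool
inc G i k = (i == proj₁ (edgeAt G k)) ∨ (i == proj₂ (edgeAt G k))

-- R(G): vertices Fin (n + |E(G)|); the first n are V(G) (via _↑ˡ_),
-- the remaining ones are the new vertices v_e (via _↑ʳ_).
R : ∀ {n} → SimpleGraph n → FinGraph
R {n} G = record { N = n Data.Nat.+ #E G ; adjH = a }
  where
  a : Fin (n Data.Nat.+ #E G) → Fin (n Data.Nat.+ #E G) → Bool
  a u v with splitAt n u | splitAt n v
  ... | inj₁ i | inj₁ j = adj G i j
  ... | inj₁ i | inj₂ k = inc G i k
  ... | inj₂ k | inj₁ j = inc G j k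
  ... | inj₂ _ | inj₂ _ = false

anyFin : ∀ {N} → (Fin N → Bool) → Bool
anyFin {N} p = BLA.any p (allFin N)

B : (H : FinGraph) → Subset (N H) → Subset (N H)
B H S = tabulate λ v → not (lookup S v) ∧ anyFin (λ u → lookup S u ∧ adjH H u v)

∂ : (H : FinGraph) → Subset (N H) → ℤ
∂ H S = + ∣ B H S ∣ - + ∣ S ∣

IsDifferentialSet : (H : FinGraph) → Subset (N H) → Set
IsDifferentialSet H S = ∀ (T : Subset (N H)) → ∂ H T ≤ ∂ H S

IsDominating : ∀ {n} → SimpleGraph n → Subset n → Set
IsDominating {n} G S = ∀ (v : Fin n) → v ∈ S ⊎ Σ (Fin n) (λ u → u ∈ S × adj G u v ≡ true)

embedV : ∀ {n} (G : SimpleGraph n) → Subset n → Subset (N (R G))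
embedV G S = S ++ replicate _ false

-- Start from a differential set T of R(G). Trading a new vertex v_e ∈ T, e = xy, for its endpoint x
-- never lowers ∂: v_e leaves T and enters the boundary, while the only vertex that can leave the
-- boundary is x itself, because the other neighbour y of v_e is adjacent to x. Each trade removes a
-- new vertex, so repeating it ends in a differential set S ⊆ V. Then, while some vertex v of G is not
-- dominated by S, add v to S: no vertex leaves the boundary and v_e enters it for any edge e at v
-- (one exists since G is connected with n ≥ 2), since both endpoints of e lie outside S and B(S).
-- Each addition shrinks V ∖ S, so this ends in a dominating set that is still differential.

module Submission where

open import Defs hiding (sym)
open import Data.Nat using (ℕ; _≤_)
open import Data.Fin.Subset using (Subset)
open import Data.Product using (Σ; _×_)

open import Data.Bool as Bool using (Bool; true; false; not; _∧_; _∨_; if_then_else_)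
open import Data.Bool.Properties using (T-≡; T-∨; ∨-zeroʳ)
open import Data.Fin as Fin using (Fin; zero; suc; toℕ; _≟_; _↑ˡ_; _↑ʳ_; splitAt; punchIn)
open import Data.Fin.Properties as Fin
  using (all?; any?; ¬∀⟶∃¬; splitAt-↑ˡ; splitAt-↑ʳ; splitAt⁻¹-↑ˡ; splitAt⁻¹-↑ʳ; punchInᵢ≢i)
open import Data.Fin.Subset using (_∈_; _∉_; _⊆_; _─_; _-_; _∪_; _∩_; ∁; ⁅_⁆; ∣_∣; ⊥; ⊤; inside; outside)
open import Data.Fin.Subset.Properties
open import Data.Integer as ℤ using (_⊖_)
import Data.Integer.Properties as ℤ
open import Data.List using ([]; _∷_; allFin)
open import Data.List.Membership.Propositional using (lose) renaming (_∈_ to _∈ₗ_)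
open import Data.List.Membership.Propositional.Properties
  using (∈-allFin; ∈-concatMap⁺; ∈-concatMap⁻; ∈-lookup)
open import Data.List.Relation.Unary.Any as Any using (here; there; satisfied)
open import Data.List.Relation.Unary.Any.Properties using (any⁺; any⁻; lookup-index)
open import Data.Nat as ℕ using (zero; suc; _+_; _<_; _<ᵇ_; z≤n; s≤s)
open import Data.Nat.Induction using (<-wellFounded)
import Data.Nat.Properties as ℕ
open import Data.Nat.Solver using (module +-*-Solver)
open import Data.Product using (∃; _,_; proj₁; proj₂)
open import Data.Sum as Sum using (_⊎_; inj₁; inj₂)
import Data.Vec as Vec
open import Data.Vec using (Vec; []; _∷_; _++_; _[_]=_; here; there; lookup)
open import Data.Vec.Properties using (lookup∘tabulate; []=⇒lookup; lookup⇒[]=; lookup-++ˡ; lookup-++ʳ)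
open import Function using (_on_; _∘_)
open import Function.Bundles using (Equivalence)
open import Induction.WellFounded using (Acc; acc)
open import Level using (0ℓ)
open import Relation.Binary using (Rel; Reflexive; Transitive; TotalPreorder; tri<; tri≈; tri>)
import Relation.Binary.Construct.On as On
open import Relation.Binary.PropositionalEquality
open import Relation.Nullary using (Dec; contradiction; yes; no)
open import Relation.Nullary.Decidable using (toWitness; fromWitness; _⊎-dec_; _×-dec_)
open import Relation.Unary using (Pred)

private
  variable
    k : ℕ
    x y : Fin k
    p q : Subset k

[]=-transport : ∀ {A : Set} {a b} {xs : Vec A a} {ys : Vec A b} {i j v} →
                lookup xs i ≡ lookup ys j → xs [ i ]= v → ys [ j ]= v
[]=-transport {ys = ys} {j = j} eq xs[i]=v = lookup⇒[]= j ys (trans (sym eq) ([]=⇒lookup xs[i]=v))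

x∈p─q⁻ : ∀ (p q : Subset k) → x ∈ p ─ q → x ∈ p × x ∉ q
x∈p─q⁻ (inside  ∷ p) (outside ∷ q) here = here , λ ()
x∈p─q⁻ {x = zero} (inside  ∷ p) (inside  ∷ q) ()
x∈p─q⁻ {x = zero} (outside ∷ p) (inside  ∷ q) ()
x∈p─q⁻ {x = zero} (outside ∷ p) (outside ∷ q) ()
x∈p─q⁻ (s ∷ p) (t ∷ q) (there x∈p─q) =
  let x∈p , x∉q = x∈p─q⁻ p q x∈p─q in there x∈p , λ { (there x∈q) → x∉q x∈q }

∣p∣+∣q─p∣≡∣q∣+∣p─q∣ : ∀ (p q : Subset k) → ∣ p ∣ + ∣ q ─ p ∣ ≡ ∣ q ∣ + ∣ p ─ q ∣
∣p∣+∣q─p∣≡∣q∣+∣p─q∣ []            []            = refl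
∣p∣+∣q─p∣≡∣q∣+∣p─q∣ (inside  ∷ p) (inside  ∷ q) = cong suc (∣p∣+∣q─p∣≡∣q∣+∣p─q∣ p q)
∣p∣+∣q─p∣≡∣q∣+∣p─q∣ (outside ∷ p) (outside ∷ q) = ∣p∣+∣q─p∣≡∣q∣+∣p─q∣ p q
∣p∣+∣q─p∣≡∣q∣+∣p─q∣ (inside  ∷ p) (outside ∷ q) =
  trans (cong suc (∣p∣+∣q─p∣≡∣q∣+∣p─q∣ p q)) (sym (ℕ.+-suc _ _))
∣p∣+∣q─p∣≡∣q∣+∣p─q∣ (outside ∷ p) (inside  ∷ q) =
  trans (ℕ.+-suc _ _) (cong suc (∣p∣+∣q─p∣≡∣q∣+∣p─q∣ p q))

∣p─q∣≤1 : (∀ {z} → z ∈ p → z ∉ q → z ≡ x) → ∣ p ─ q ∣ ≤ 1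
∣p─q∣≤1 {p = p} {q} {x} only-x = ℕ.≤-trans (p⊆q⇒∣p∣≤∣q∣ p─q⊆⁅x⁆) (ℕ.≤-reflexive (∣⁅x⁆∣≡1 x))
  where
  p─q⊆⁅x⁆ : p ─ q ⊆ ⁅ x ⁆
  p─q⊆⁅x⁆ z∈p─q = let z∈p , z∉q = x∈p─q⁻ p q z∈p─q in
    subst (_∈ ⁅ x ⁆) (sym (only-x z∈p z∉q)) (x∈⁅x⁆ x)

∣p─q∣≡0 : p ⊆ q → ∣ p ─ q ∣ ≡ 0
∣p─q∣≡0 {k} {p} {q} p⊆q = ℕ.n≤0⇒n≡0 (ℕ.≤-trans (p⊆q⇒∣p∣≤∣q∣ p─q⊆⊥) (ℕ.≤-reflexive (∣⊥∣≡0 k)))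
  where
  p─q⊆⊥ : p ─ q ⊆ ⊥
  p─q⊆⊥ z∈p─q = let z∈p , z∉q = x∈p─q⁻ p q z∈p─q in contradiction (p⊆q z∈p) z∉q

1≤∣p─q∣ : x ∈ p → x ∉ q → 1 ≤ ∣ p ─ q ∣
1≤∣p─q∣ {x = x} x∈p x∉q = ℕ.≤-trans (ℕ.≤-reflexive (sym (∣⁅x⁆∣≡1 x)))
  (p⊆q⇒∣p∣≤∣q∣ λ z∈⁅x⁆ → subst (_∈ _) (sym (x∈⁅y⁆⇒x≡y x z∈⁅x⁆)) (x∈p∧x∉q⇒x∈p─q x∈p x∉q))

x∈p-y∪⁅z⁆⁻ : ∀ {z} (p : Subset k) → x ∈ (p - y) ∪ ⁅ z ⁆ → x ≡ z ⊎ (x ∈ p × x ≢ y)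
x∈p-y∪⁅z⁆⁻ {z = z} p x∈ with x∈p∪q⁻ (p - _) ⁅ z ⁆ x∈
... | inj₂ x∈⁅z⁆ = inj₁ (x∈⁅y⁆⇒x≡y z x∈⁅z⁆)
... | inj₁ x∈p-y = let x∈p , x∉⁅y⁆ = x∈p─q⁻ p _ x∈p-y in inj₂ (x∈p , x∉⁅y⁆⇒x≢y x∉⁅y⁆)

x∈p∪⁅y⁆⁻ : ∀ (p : Subset k) → x ∈ p ∪ ⁅ y ⁆ → x ∈ p ⊎ x ≡ y
x∈p∪⁅y⁆⁻ {y = y} p x∈ with x∈p∪q⁻ p ⁅ y ⁆ x∈
... | inj₁ x∈p   = inj₁ x∈p
... | inj₂ x∈⁅y⁆ = inj₂ (x∈⁅y⁆⇒x≡y y x∈⁅y⁆)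

∣∁[p∪⁅x⁆]∣<∣∁p∣ : x ∉ p → ∣ ∁ (p ∪ ⁅ x ⁆) ∣ < ∣ ∁ p ∣
∣∁[p∪⁅x⁆]∣<∣∁p∣ {x = x} {p = p} x∉p = p⊂q⇒∣p∣<∣q∣ (shrinks , x , x∉p⇒x∈∁p x∉p , x∉∁[p∪⁅x⁆])
  where
  shrinks : ∁ (p ∪ ⁅ x ⁆) ⊆ ∁ p
  shrinks w∈ = x∉p⇒x∈∁p λ w∈p → x∈∁p⇒x∉p w∈ (x∈p∪q⁺ (inj₁ w∈p))
  x∉∁[p∪⁅x⁆] : x ∉ ∁ (p ∪ ⁅ x ⁆)
  x∉∁[p∪⁅x⁆] x∈ = x∈∁p⇒x∉p x∈ (x∈p∪q⁺ (inj₂ (x∈⁅x⁆ x)))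

∣[p-x∪⁅y⁆]∩q∣<∣p∩q∣ : ∀ (p q : Subset k) → x ∈ p → x ∈ q → y ∉ q → ∣ ((p - x) ∪ ⁅ y ⁆) ∩ q ∣ < ∣ p ∩ q ∣
∣[p-x∪⁅y⁆]∩q∣<∣p∩q∣ {x = x} {y} p q x∈p x∈q y∉q = p⊂q⇒∣p∣<∣q∣ (shrinks , x , x∈p∩q⁺ (x∈p , x∈q) , x∉)
  where
  shrinks : ((p - x) ∪ ⁅ y ⁆) ∩ q ⊆ p ∩ q
  shrinks w∈ with x∈p∩q⁻ _ q w∈
  ... | w∈′ , w∈q with x∈p-y∪⁅z⁆⁻ p w∈′
  ...   | inj₁ refl      = contradiction w∈q y∉q
  ...   | inj₂ (w∈p , _) = x∈p∩q⁺ (w∈p , w∈q)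
  x∉ : x ∉ ((p - x) ∪ ⁅ y ⁆) ∩ q
  x∉ x∈ with x∈p-y∪⁅z⁆⁻ p (proj₁ (x∈p∩q⁻ _ q x∈))
  ... | inj₁ refl      = y∉q x∈q
  ... | inj₂ (_ , x≢x) = x≢x refl

module _ {m} (p : Subset k) (q : Subset m) where

  ∈-++⁻ˡ : x ↑ˡ m ∈ p ++ q → x ∈ p
  ∈-++⁻ˡ {x} = []=-transport (lookup-++ˡ p q x)

  ∈-++⁻ʳ : ∀ {z} → k ↑ʳ z ∈ p ++ q → z ∈ q
  ∈-++⁻ʳ {z} = []=-transport (lookup-++ʳ p q z)

  ∈-++⁺ʳ : ∀ {z} → z ∈ q → k ↑ʳ z ∈ p ++ q
  ∈-++⁺ʳ {z} = []=-transport (sym (lookup-++ʳ p q z))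

[p∪⁅x⁆]++⊥≡[p++⊥]∪⁅x↑ˡ⁆ : ∀ {m} (p : Subset k) x → (p ∪ ⁅ x ⁆) ++ ⊥ {m} ≡ (p ++ ⊥) ∪ ⁅ x ↑ˡ m ⁆
[p∪⁅x⁆]++⊥≡[p++⊥]∪⁅x↑ˡ⁆ (s ∷ p) zero    =
  cong ((s ∨ true) ∷_) (trans (cong (_++ ⊥) (∪-identityʳ p)) (sym (∪-identityʳ (p ++ ⊥))))
[p∪⁅x⁆]++⊥≡[p++⊥]∪⁅x↑ˡ⁆ (s ∷ p) (suc x) = cong ((s ∨ false) ∷_) ([p∪⁅x⁆]++⊥≡[p++⊥]∪⁅x↑ˡ⁆ p x)

m⊖n≤o⊖q : ∀ {m n o q} → q + m ≤ n + o → m ⊖ n ℤ.≤ o ⊖ q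
m⊖n≤o⊖q {m} {n} {o} {q} q+m≤n+o = begin
  m ⊖ n             ≡⟨ sym (ℤ.+-cancelˡ-⊖ q m n) ⟩
  (q + m) ⊖ (q + n) ≤⟨ ℤ.⊖-monoˡ-≤ (q + n) q+m≤n+o ⟩
  (n + o) ⊖ (q + n) ≡⟨ cong ((n + o) ⊖_) (ℕ.+-comm q n) ⟩
  (n + o) ⊖ (n + q) ≡⟨ ℤ.+-cancelˡ-⊖ n o q ⟩
  o ⊖ q             ∎
  where open ℤ.≤-Reasoning

∣p∣⊖∣p′∣≤∣q∣⊖∣q′∣ : ∀ {k′} (p q : Subset k) (p′ q′ : Subset k′) →
                   ∣ p ─ q ∣ + ∣ q′ ─ p′ ∣ ≤ ∣ q ─ p ∣ + ∣ p′ ─ q′ ∣ → ∣ p ∣ ⊖ ∣ p′ ∣ ℤ.≤ ∣ q ∣ ⊖ ∣ q′ ∣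
∣p∣⊖∣p′∣≤∣q∣⊖∣q′∣ p q p′ q′ loss≤gain =
  m⊖n≤o⊖q {∣ p ∣} {∣ p′ ∣} {∣ q ∣} {∣ q′ ∣} (ℕ.+-cancelʳ-≤ (∣ q ─ p ∣ + ∣ p′ ─ q′ ∣) _ _ (begin
  (∣ q′ ∣ + ∣ p ∣) + (∣ q ─ p ∣ + ∣ p′ ─ q′ ∣)
    ≡⟨ solve 4 (λ a b c d → (a :+ b) :+ (c :+ d) := (b :+ c) :+ (a :+ d)) refl
               (∣ q′ ∣) (∣ p ∣) (∣ q ─ p ∣) (∣ p′ ─ q′ ∣) ⟩
  (∣ p ∣ + ∣ q ─ p ∣) + (∣ q′ ∣ + ∣ p′ ─ q′ ∣)
    ≡⟨ cong₂ _+_ (∣p∣+∣q─p∣≡∣q∣+∣p─q∣ p q) (∣p∣+∣q─p∣≡∣q∣+∣p─q∣ q′ p′) ⟩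
  (∣ q ∣ + ∣ p ─ q ∣) + (∣ p′ ∣ + ∣ q′ ─ p′ ∣)
    ≡⟨ solve 4 (λ a b c d → (a :+ b) :+ (c :+ d) := (c :+ a) :+ (b :+ d)) refl
               (∣ q ∣) (∣ p ─ q ∣) (∣ p′ ∣) (∣ q′ ─ p′ ∣) ⟩
  (∣ p′ ∣ + ∣ q ∣) + (∣ p ─ q ∣ + ∣ q′ ─ p′ ∣)
    ≤⟨ ℕ.+-monoʳ-≤ (∣ p′ ∣ + ∣ q ∣) loss≤gain ⟩
  (∣ p′ ∣ + ∣ q ∣) + (∣ q ─ p ∣ + ∣ p′ ─ q′ ∣) ∎))
  where
  open ℕ.≤-Reasoning
  open +-*-Solver

module _ {A : Set} (_≼_ : Rel A 0ℓ) (≼-refl : Reflexive _≼_) (≼-trans : Transitive _≼_)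
         {Done : Pred A 0ℓ} (μ : A → ℕ) (improve : ∀ x → Done x ⊎ ∃ λ y → x ≼ y × μ y < μ x) where

  climb : ∀ x → ∃ λ y → x ≼ y × Done y
  climb x = go x (On.wellFounded μ <-wellFounded x)
    where
    go : ∀ x → Acc (_<_ on μ) x → ∃ λ y → x ≼ y × Done y
    go x (acc rec) with improve x
    ... | inj₁ done              = x , ≼-refl , done
    ... | inj₂ (y , x≼y , μy<μx) = let z , y≼z , done = go y (rec μy<μx) in z , ≼-trans x≼y y≼z , done

module _ {c ℓ₁ ℓ₂} (O : TotalPreorder c ℓ₁ ℓ₂) where
  open TotalPreorder O using (Carrier; _≲_; total) renaming (refl to ≲-refl; trans to ≲-trans)

  maximiser : ∀ n (f : Subset n → Carrier) → ∃ λ S → ∀ T → f T ≲ f S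
  maximiser zero    f = [] , λ { [] → ≲-refl }
  maximiser (suc n) f with maximiser n (λ T → f (inside ∷ T)) | maximiser n (λ T → f (outside ∷ T))
  ... | S₁ , max₁ | S₀ , max₀ with total (f (inside ∷ S₁)) (f (outside ∷ S₀))
  ... | inj₁ S₁≲S₀ = outside ∷ S₀ , λ { (inside ∷ T) → ≲-trans (max₁ T) S₁≲S₀ ; (outside ∷ T) → max₀ T }
  ... | inj₂ S₀≲S₁ = inside ∷ S₁ , λ { (inside ∷ T) → max₁ T ; (outside ∷ T) → ≲-trans (max₀ T) S₀≲S₁ }

anyFin⁺ : ∀ {N} (f : Fin N → Bool) {x} → f x ≡ true → anyFin f ≡ true
anyFin⁺ {N} f {x} fx =
  Equivalence.to T-≡ (any⁺ f (lose (∈-allFin x) (Equivalence.from (T-≡ {f x}) fx)))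

anyFin⁻ : ∀ {N} (f : Fin N → Bool) → anyFin f ≡ true → ∃ λ x → f x ≡ true
anyFin⁻ {N} f h = let x , fx = satisfied (any⁻ f (allFin N) (Equivalence.from (T-≡ {anyFin f}) h)) in
  x , Equivalence.to T-≡ fx

module _ (H : FinGraph) where

  private
    lookup-B : ∀ S v → lookup (B H S) v ≡ not (lookup S v) ∧ anyFin (λ u → lookup S u ∧ adjH H u v)
    lookup-B S v = lookup∘tabulate _ v

  ∈-B⁺ : ∀ {S u v} → v ∉ S → u ∈ S → adjH H u v ≡ true → v ∈ B H S
  ∈-B⁺ {S} {u} {v} v∉S u∈S uv =
    lookup⇒[]= v (B H S) (trans (lookup-B S v) (cong₂ (λ a b → not a ∧ b) v∉S′ (anyFin⁺ S-adj u∈S′)))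
    where
    S-adj : Fin (N H) → Bool
    S-adj w = lookup S w ∧ adjH H w v
    v∉S′ : lookup S v ≡ false
    v∉S′ with lookup S v in eq
    ... | false = refl
    ... | true  = contradiction (lookup⇒[]= v S eq) v∉S
    u∈S′ : S-adj u ≡ true
    u∈S′ = cong₂ _∧_ ([]=⇒lookup u∈S) uv

  ∈-B⁻ : ∀ {S v} → v ∈ B H S → v ∉ S × ∃ λ u → u ∈ S × adjH H u v ≡ true
  ∈-B⁻ {S} {v} v∈B with lookup S v in eq | trans (sym (lookup-B S v)) ([]=⇒lookup v∈B)
  ... | false | has-neighbour with anyFin⁻ _ has-neighbour
  ...   | u , u∈S∧uv with lookup S u in eq′ | adjH H u v in uv
  ...     | true | true = (λ v∈S → contradiction (trans (sym ([]=⇒lookup v∈S)) eq) λ ())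
                          , u , lookup⇒[]= u S eq′ , uv

  ∂-mono : ∀ P Q → ∣ B H P ─ B H Q ∣ + ∣ Q ─ P ∣ ≤ ∣ B H Q ─ B H P ∣ + ∣ P ─ Q ∣ → ∂ H P ℤ.≤ ∂ H Q
  ∂-mono P Q loss≤gain = begin
    ∂ H P              ≡⟨ ℤ.[+m]-[+n]≡m⊖n ∣ B H P ∣ ∣ P ∣ ⟩
    ∣ B H P ∣ ⊖ ∣ P ∣  ≤⟨ ∣p∣⊖∣p′∣≤∣q∣⊖∣q′∣ (B H P) (B H Q) P Q loss≤gain ⟩
    ∣ B H Q ∣ ⊖ ∣ Q ∣  ≡⟨ ℤ.[+m]-[+n]≡m⊖n ∣ B H Q ∣ ∣ Q ∣ ⟨
    ∂ H Q              ∎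
    where open ℤ.≤-Reasoning

  ∂-swap : ∀ {P f x} → f ∈ P → f ≢ x → adjH H x f ≡ true →
           (∀ {w} → adjH H f w ≡ true → w ≢ x → adjH H x w ≡ true) →
           ∂ H P ℤ.≤ ∂ H ((P - f) ∪ ⁅ x ⁆)
  ∂-swap {P} {f} {x} f∈P f≢x xf x-covers-f =
    ∂-mono P Q (ℕ.+-mono-≤ (ℕ.≤-trans (∣p─q∣≤1 lost) (1≤∣p─q∣ f∈BQ f∉BP))
                           (ℕ.≤-trans (∣p─q∣≤1 new) (1≤∣p─q∣ f∈P f∉Q)))
    where
    Q = (P - f) ∪ ⁅ x ⁆
    x∈Q : x ∈ Q
    x∈Q = x∈p∪q⁺ (inj₂ (x∈⁅x⁆ x))
    kept : ∀ {w} → w ∈ P → w ≢ f → w ∈ Q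
    kept w∈P w≢f = x∈p∪q⁺ (inj₁ (x∈p∧x≢y⇒x∈p-y w∈P w≢f))
    new : ∀ {w} → w ∈ Q → w ∉ P → w ≡ x
    new w∈Q w∉P with x∈p-y∪⁅z⁆⁻ P w∈Q
    ... | inj₁ w≡x        = w≡x
    ... | inj₂ (w∈P , _) = contradiction w∈P w∉P
    f∉Q : f ∉ Q
    f∉Q f∈Q with x∈p-y∪⁅z⁆⁻ P f∈Q
    ... | inj₁ f≡x        = f≢x f≡x
    ... | inj₂ (_ , f≢f) = f≢f refl
    f∈BQ : f ∈ B H Q
    f∈BQ = ∈-B⁺ f∉Q x∈Q xf
    f∉BP : f ∉ B H P
    f∉BP f∈BP = proj₁ (∈-B⁻ f∈BP) f∈P
    Q-dominates : ∀ {u w} → u ∈ P → adjH H u w ≡ true → w ≢ x → ∃ λ z → z ∈ Q × adjH H z w ≡ true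
    Q-dominates {u} u∈P uw w≢x with u ≟ f
    ... | yes refl = x , x∈Q , x-covers-f uw w≢x
    ... | no  u≢f  = u , kept u∈P u≢f , uw
    lost : ∀ {w} → w ∈ B H P → w ∉ B H Q → w ≡ x
    lost {w} w∈BP w∉BQ with w ≟ x | ∈-B⁻ w∈BP
    ... | yes w≡x | _                  = w≡x
    ... | no  w≢x | w∉P , u , u∈P , uw =
      let z , z∈Q , zw = Q-dominates u∈P uw w≢x in
      contradiction (∈-B⁺ (λ w∈Q → w≢x (new w∈Q w∉P)) z∈Q zw) w∉BQ

  ∂-add : ∀ {P v e} → v ∉ B H P → e ∉ P → e ∉ B H P → e ≢ v → adjH H v e ≡ true →
          ∂ H P ℤ.≤ ∂ H (P ∪ ⁅ v ⁆)
  ∂-add {P} {v} {e} v∉BP e∉P e∉BP e≢v ve = ∂-mono P Q (begin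
    ∣ B H P ─ B H Q ∣ + ∣ Q ─ P ∣  ≡⟨ cong (_+ ∣ Q ─ P ∣) (∣p─q∣≡0 BP⊆BQ) ⟩
    ∣ Q ─ P ∣                      ≤⟨ ℕ.≤-trans (∣p─q∣≤1 new) (1≤∣p─q∣ e∈BQ e∉BP) ⟩
    ∣ B H Q ─ B H P ∣              ≤⟨ ℕ.m≤m+n _ _ ⟩
    ∣ B H Q ─ B H P ∣ + ∣ P ─ Q ∣  ∎)
    where
    open ℕ.≤-Reasoning
    Q = P ∪ ⁅ v ⁆
    new : ∀ {w} → w ∈ Q → w ∉ P → w ≡ v
    new w∈Q w∉P with x∈p∪⁅y⁆⁻ P w∈Q
    ... | inj₁ w∈P = contradiction w∈P w∉P
    ... | inj₂ w≡v = w≡v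
    e∈BQ : e ∈ B H Q
    e∈BQ = ∈-B⁺ (λ e∈Q → e≢v (new e∈Q e∉P)) (x∈p∪q⁺ (inj₂ (x∈⁅x⁆ v))) ve
    BP⊆BQ : B H P ⊆ B H Q
    BP⊆BQ {w} w∈BP with ∈-B⁻ w∈BP
    ... | w∉P , u , u∈P , uw = ∈-B⁺ w∉Q (x∈p∪q⁺ (inj₁ u∈P)) uw
      where
      w∉Q : w ∉ Q
      w∉Q w∈Q = v∉BP (subst (_∈ B H P) (new w∈Q w∉P) w∈BP)

==-refl : ∀ (i : Fin k) → (i == i) ≡ true
==-refl i = Equivalence.to T-≡ (fromWitness refl)

Undominated : ∀ {n} → SimpleGraph n → Subset n → Fin n → Set
Undominated G S i = i ∉ S × (∀ {j} → j ∈ S → adj G j i ≢ true)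

dominated? : ∀ {n} (G : SimpleGraph n) S v → Dec (v ∈ S ⊎ ∃ λ u → u ∈ S × adj G u v ≡ true)
dominated? G S v = (v ∈? S) ⊎-dec any? (λ u → (u ∈? S) ×-dec (adj G u v Bool.≟ true))

dominating-or-undominated : ∀ {n} (G : SimpleGraph n) S → IsDominating G S ⊎ ∃ (Undominated G S)
dominating-or-undominated {n} G S with all? (dominated? G S)
... | yes dominating  = inj₁ dominating
... | no  ¬dominating =
  let i , i-undominated = ¬∀⟶∃¬ n _ (dominated? G S) ¬dominating in
  inj₂ (i , i-undominated ∘ inj₁ , λ j∈S ji → i-undominated (inj₂ (_ , j∈S , ji)))

walk-start : ∀ {n} {G : SimpleGraph n} {i j} → Walk G i j → i ≢ j → ∃ λ l → adj G i l ≡ true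
walk-start here         i≢i = contradiction refl i≢i
walk-start (step il _)  _   = _ , il

has-neighbour : ∀ {n} (G : SimpleGraph n) → 2 ≤ n → Connected G → ∀ i → ∃ λ j → adj G i j ≡ true
has-neighbour G (s≤s (s≤s z≤n)) connected i =
  walk-start (connected i (punchIn i zero)) (λ i≡j → punchInᵢ≢i i zero (sym i≡j))

module RGraph {n} (G : SimpleGraph n) where

  m : ℕ
  m = #E G

  H : FinGraph
  H = R G

  _∂≤_ : Subset (n + m) → Subset (n + m) → Set
  P ∂≤ Q = ∂ H P ℤ.≤ ∂ H Q

  vertex : Fin n → Fin (n + m)
  vertex i = i ↑ˡ m

  edgeVertex : Fin m → Fin (n + m)
  edgeVertex k = n ↑ʳ k

  data VertexView : Fin (n + m) → Set where
    ofVertex : ∀ i → VertexView (vertex i)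
    ofEdge   : ∀ k → VertexView (edgeVertex k)

  view : ∀ v → VertexView v
  view v with splitAt n v in eq
  ... | inj₁ i = subst VertexView (splitAt⁻¹-↑ˡ eq) (ofVertex i)
  ... | inj₂ k = subst VertexView (splitAt⁻¹-↑ʳ eq) (ofEdge k)

  vertex≢edgeVertex : ∀ {i k} → vertex i ≢ edgeVertex k
  vertex≢edgeVertex {i} {k} eq
    with trans (sym (splitAt-↑ˡ n i m)) (trans (cong (splitAt n) eq) (splitAt-↑ʳ n m k))
  ... | ()

  adj-vertex-vertex : ∀ i j → adjH H (vertex i) (vertex j) ≡ adj G i j
  adj-vertex-vertex i j rewrite splitAt-↑ˡ n i m | splitAt-↑ˡ n j m = refl

  adj-vertex-edge : ∀ i k → adjH H (vertex i) (edgeVertex k) ≡ inc G i k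
  adj-vertex-edge i k rewrite splitAt-↑ˡ n i m | splitAt-↑ʳ n m k = refl

  adj-edge-vertex : ∀ k j → adjH H (edgeVertex k) (vertex j) ≡ inc G j k
  adj-edge-vertex k j rewrite splitAt-↑ʳ n m k | splitAt-↑ˡ n j m = refl

  adj-edge-edge : ∀ k l → adjH H (edgeVertex k) (edgeVertex l) ≡ false
  adj-edge-edge k l rewrite splitAt-↑ʳ n m k | splitAt-↑ʳ n m l = refl

  end₁ end₂ : Fin m → Fin n
  end₁ k = proj₁ (edgeAt G k)
  end₂ k = proj₂ (edgeAt G k)

  ∈-edges⁻ : ∀ {e} → e ∈ₗ edges G → adj G (proj₁ e) (proj₂ e) ≡ true
  ∈-edges⁻ e∈ with satisfied (∈-concatMap⁻ _ {xs = allFin n} e∈)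
  ... | i , e∈row with satisfied (∈-concatMap⁻ _ {xs = allFin n} e∈row)
  ... | j , e∈cell with toℕ i <ᵇ toℕ j | adj G i j in ij | e∈cell
  ... | true  | true  | here refl = ij
  ... | true  | false | ()
  ... | false | _     | ()

  ∈-edges⁺ : ∀ {i j} → adj G i j ≡ true → i Fin.< j → (i , j) ∈ₗ edges G
  ∈-edges⁺ {i} {j} ij i<j = ∈-concatMap⁺ _ (lose (∈-allFin i) (∈-concatMap⁺ _ (lose (∈-allFin j) cell)))
    where
    cell : (i , j) ∈ₗ (if (toℕ i <ᵇ toℕ j) ∧ adj G i j then (i , j) ∷ [] else [])
    cell rewrite Equivalence.to T-≡ (ℕ.<⇒<ᵇ i<j) | ij = here refl

  ends-adjacent : ∀ k → adj G (end₁ k) (end₂ k) ≡ true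
  ends-adjacent k = ∈-edges⁻ (∈-lookup {xs = edges G} k)

  inc-end₁ : ∀ k → inc G (end₁ k) k ≡ true
  inc-end₁ k = cong (_∨ (end₁ k == end₂ k)) (==-refl (end₁ k))

  inc-end₂ : ∀ k → inc G (end₂ k) k ≡ true
  inc-end₂ k = trans (cong (end₂ k == end₁ k ∨_) (==-refl (end₂ k))) (∨-zeroʳ _)

  inc⁻ : ∀ {i k} → inc G i k ≡ true → i ≡ end₁ k ⊎ i ≡ end₂ k
  inc⁻ {i} {k} ik = Sum.map (toWitness {a? = i ≟ end₁ k}) (toWitness {a? = i ≟ end₂ k})
                            (Equivalence.to T-∨ (Equivalence.from T-≡ ik))

  co-incident⇒adjacent : ∀ {i j k} → inc G i k ≡ true → inc G j k ≡ true → i ≢ j → adj G i j ≡ true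
  co-incident⇒adjacent {i} {j} {k} ik jk i≢j with inc⁻ {i} {k} ik | inc⁻ {j} {k} jk
  ... | inj₁ refl | inj₂ refl = ends-adjacent _
  ... | inj₂ refl | inj₁ refl = trans (SimpleGraph.sym G _ _) (ends-adjacent _)
  ... | inj₁ refl | inj₁ refl = contradiction refl i≢j
  ... | inj₂ refl | inj₂ refl = contradiction refl i≢j

  ∈-edges⇒edgeAt : ∀ {e} → e ∈ₗ edges G → ∃ λ k → edgeAt G k ≡ e
  ∈-edges⇒edgeAt e∈ = Any.index e∈ , sym (lookup-index e∈)

  incident-edge : ∀ {i j} → adj G i j ≡ true → ∃ λ k → inc G i k ≡ true
  incident-edge {i} {j} ij with Fin.<-cmp i j
  ... | tri< i<j _ _ = let k , k≡ij = ∈-edges⇒edgeAt (∈-edges⁺ ij i<j) in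
    k , subst (λ e → inc G (proj₁ e) k ≡ true) k≡ij (inc-end₁ k)
  ... | tri≈ _ refl _ = contradiction (trans (sym ij) (irrefl G i)) λ ()
  ... | tri> _ _ j<i = let k , k≡ji = ∈-edges⇒edgeAt (∈-edges⁺ (trans (SimpleGraph.sym G j i) ij) j<i) in
    k , subst (λ e → inc G (proj₂ e) k ≡ true) k≡ji (inc-end₂ k)

  edgeVertex-neighbour : ∀ {k w} → adjH H (edgeVertex k) w ≡ true →
                         w ≡ vertex (end₁ k) ⊎ w ≡ vertex (end₂ k)
  edgeVertex-neighbour {k} {w} kw with view w
  ... | ofVertex j = Sum.map (cong vertex) (cong vertex) (inc⁻ (trans (sym (adj-edge-vertex k j)) kw))
  ... | ofEdge l   = contradiction (trans (sym kw) (adj-edge-edge k l)) λ ()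

  edgeVertices : Subset (n + m)
  edgeVertices = ⊥ {n} ++ ⊤ {m}

  contract : Subset (n + m) → Fin m → Subset (n + m)
  contract P k = (P - edgeVertex k) ∪ ⁅ vertex (end₁ k) ⁆

  ∂-contract : ∀ {P k} → edgeVertex k ∈ P → P ∂≤ contract P k
  ∂-contract {P} {k} k∈P =
    ∂-swap H k∈P (vertex≢edgeVertex ∘ sym) (trans (adj-vertex-edge (end₁ k) k) (inc-end₁ k)) end₁-covers
    where
    end₁-covers : ∀ {w} → adjH H (edgeVertex k) w ≡ true → w ≢ vertex (end₁ k) →
                  adjH H (vertex (end₁ k)) w ≡ true
    end₁-covers kw w≢end₁ with edgeVertex-neighbour kw
    ... | inj₁ w≡end₁ = contradiction w≡end₁ w≢end₁
    ... | inj₂ refl   = trans (adj-vertex-vertex (end₁ k) (end₂ k)) (ends-adjacent k)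

  embedded-or-edgeVertex : ∀ P → (∃ λ S → P ≡ embedV G S) ⊎ ∃ λ k → edgeVertex k ∈ P
  embedded-or-edgeVertex P with Vec.splitAt n P
  ... | S , Y , refl with nonempty? Y
  ...   | yes (k , k∈Y) = inj₂ (k , ∈-++⁺ʳ S Y k∈Y)
  ...   | no  Y-empty   = inj₁ (S , cong (S ++_) (Empty-unique Y-empty))

  contract-step : ∀ P → (∃ λ S → P ≡ embedV G S) ⊎
                        ∃ λ Q → P ∂≤ Q × ∣ Q ∩ edgeVertices ∣ < ∣ P ∩ edgeVertices ∣
  contract-step P with embedded-or-edgeVertex P
  ... | inj₁ embedded  = inj₁ embedded
  ... | inj₂ (k , k∈P) = inj₂ (contract P k , ∂-contract k∈P ,
    ∣[p-x∪⁅y⁆]∩q∣<∣p∩q∣ P edgeVertices k∈P (∈-++⁺ʳ (⊥ {n}) ⊤ ∈⊤) (∉⊥ ∘ ∈-++⁻ˡ ⊥ (⊤ {m})))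

  remove-edgeVertices : ∀ P → ∃ λ S → P ∂≤ embedV G S
  remove-edgeVertices P with climb _∂≤_ ℤ.≤-refl ℤ.≤-trans (λ Q → ∣ Q ∩ edgeVertices ∣) contract-step P
  ... | _ , P≤Q , S , refl = S , P≤Q

  ∈embedV⁻ : ∀ {S u} → u ∈ embedV G S → ∃ λ j → u ≡ vertex j × j ∈ S
  ∈embedV⁻ {S} {u} u∈ with view u
  ... | ofVertex j = j , refl , ∈-++⁻ˡ S ⊥ u∈
  ... | ofEdge l   = contradiction (∈-++⁻ʳ S ⊥ u∈) ∉⊥

  ∂-add-vertex : ∀ {S i k} → Undominated G S i → inc G i k ≡ true → embedV G S ∂≤ embedV G (S ∪ ⁅ i ⁆)
  ∂-add-vertex {S} {i} {k} (i∉S , undominated) ik rewrite [p∪⁅x⁆]++⊥≡[p++⊥]∪⁅x↑ˡ⁆ {m = m} S i =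
    ∂-add H i∉BP (∉⊥ ∘ ∈-++⁻ʳ S ⊥) k∉BP (vertex≢edgeVertex ∘ sym) (trans (adj-vertex-edge i k) ik)
    where
    i∉BP : vertex i ∉ B H (embedV G S)
    i∉BP i∈BP with ∈-B⁻ H i∈BP
    ... | _ , u , u∈P , ui with ∈embedV⁻ u∈P
    ...   | j , refl , j∈S = undominated j∈S (trans (sym (adj-vertex-vertex j i)) ui)
    k∉BP : edgeVertex k ∉ B H (embedV G S)
    k∉BP k∈BP with ∈-B⁻ H k∈BP
    ... | _ , u , u∈P , uk with ∈embedV⁻ u∈P
    ...   | j , refl , j∈S = undominated j∈S (co-incident⇒adjacent (trans (sym (adj-vertex-edge j k)) uk) ik
                                                                    λ j≡i → i∉S (subst (_∈ S) j≡i j∈S))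

  add-step : (∀ i → ∃ λ k → inc G i k ≡ true) →
             ∀ S → IsDominating G S ⊎ ∃ λ S′ → embedV G S ∂≤ embedV G S′ × ∣ ∁ S′ ∣ < ∣ ∁ S ∣
  add-step incident S with dominating-or-undominated G S
  ... | inj₁ dominating             = inj₁ dominating
  ... | inj₂ (i , i∉S , undominated) = inj₂ (S ∪ ⁅ i ⁆ ,
    ∂-add-vertex (i∉S , undominated) (proj₂ (incident i)) , ∣∁[p∪⁅x⁆]∣<∣∁p∣ i∉S)

  dominate : (∀ i → ∃ λ k → inc G i k ≡ true) →
             ∀ S → ∃ λ S′ → embedV G S ∂≤ embedV G S′ × IsDominating G S′
  dominate incident = climb (λ S S′ → embedV G S ∂≤ embedV G S′) ℤ.≤-refl ℤ.≤-trans (λ S → ∣ ∁ S ∣)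
                            (add-step incident)

corollary2p5 : (n : ℕ) (G : SimpleGraph n) → 3 ≤ n → Connected G →
    Σ (Subset n) (λ S → IsDifferentialSet (R G) (embedV G S) × IsDominating G S)
corollary2p5 n G 3≤n connected =
  let T , T-maximal          = maximiser ℤ.≤-totalPreorder (N (R G)) (∂ (R G))
      S₀ , T≤S₀              = remove-edgeVertices T
      S , S₀≤S , dominating = dominate incident S₀
  in S , (λ T′ → ℤ.≤-trans (T-maximal T′) (ℤ.≤-trans T≤S₀ S₀≤S)) , dominating
  where
  open RGraph G
  incident : ∀ i → ∃ λ k → inc G i k ≡ true
  incident i = incident-edge (proj₂ (has-neighbour G (ℕ.<⇒≤ 3≤n) connected i))
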